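{- Let $a\in\mathbb{N}$, $c\geq 1$, $n\geq 1$ and $2\leq k_1\leq k_2\leq\cdots\leq k_n$ be integers. Define $W_0=1$ and $W_i=\mathbf{W}(k_i,c^{W_0W_1\cdots W_{i-1}})$ for $i=1,\dots,n$. Let $l_1,\dots,l_n$ be positive integers such that for $i=2,\dots,n$ we have $l_i>(W_1-1)l_1+\cdots+(W_{i-1}-1)l_{i-1}$. Let \[ A_n=\{a+x_1l_1+\cdots+x_nl_n \mid 0\leq x_1\leq W_1-1,\dots,0\leq x_n\leq W_n-1\}. \] Then for any $c$-coloring of $A_n$ there exist positive integers $a_n$ and $d_1,\dots,d_n$, where for each $i=1,\dots,n$ we have $d_i=\alpha_i l_i$ for some integer $\alpha_i$ with $1\leq \alpha_i\leq \lfloor \frac{W_i-1}{k_i-1}\rfloor$, such that the set \[ P_n=\{a_n+x_1d_1+\cdots+x_nd_n \mid 0\leq x_1\leq k_1-1,\dots,0\leq x_n\leq k_n-1\} \] is a subset of $A_n$ and is monochromatic.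
   Context: $\mathbb{N}$ is the set of positive integers. A $c$-coloring is a map into $[c]=\{1,\dots,c\}$. For integers $k\geq 2$ and $c\geq 1$, $\mathbf{W}(k,c)$ denotes the van der Waerden number: the least integer $N$ such that every $c$-coloring of $\{1,\dots,N\}$ contains a monochromatic arithmetic progression of length $k$. -}

module Defs where

open import Data.Nat using (ℕ; zero; suc; _+_; _*_; _∸_; _^_; _≤_; _<_)
open import Data.Fin using (Fin)
open import Data.Product using (Σ; _×_; ∃; ∃-syntax)
open import Relation.Binary.PropositionalEquality using (_≡_)

-- A c-coloring of {1,…,N}: any map ℕ → Fin c (only its values on {1,…,N} matter).
HasVdW : ℕ → ℕ → ℕ → Set
HasVdW k c N =
  (χ : ℕ → Fin c) →
  ∃[ a ] ∃[ d ] (1 ≤ a × 1 ≤ d × a + (k ∸ 1) * d ≤ N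
                 × ((j : ℕ) → j < k → χ (a + j * d) ≡ χ a))

IsVdWNumber : ℕ → ℕ → ℕ → Set
IsVdWNumber k c N = HasVdW k c N × ((M : ℕ) → HasVdW k c M → N ≤ M)

IsVdWFunction : (ℕ → ℕ → ℕ) → Set
IsVdWFunction W = (k c : ℕ) → 2 ≤ k → 1 ≤ c → IsVdWNumber k c (W k c)

sumTo : (ℕ → ℕ) → ℕ → ℕ
sumTo f zero = 0
sumTo f (suc i) = sumTo f i + f (suc i)

mutual
  Wseq : (ℕ → ℕ → ℕ) → (ℕ → ℕ) → ℕ → ℕ → ℕ
  Wseq W k c zero = 1
  Wseq W k c (suc i) = W (k (suc i)) (c ^ Wprod W k c i)

  Wprod : (ℕ → ℕ → ℕ) → (ℕ → ℕ) → ℕ → ℕ → ℕ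
  Wprod W k c zero = Wseq W k c zero
  Wprod W k c (suc i) = Wprod W k c i * Wseq W k c (suc i)

InA : (ℕ → ℕ → ℕ) → (ℕ → ℕ) → ℕ → ℕ → (ℕ → ℕ) → ℕ → ℕ → Set
InA W k c n l a m =
  Σ (ℕ → ℕ) λ x → (((i : ℕ) → 1 ≤ i → i ≤ n → x i < Wseq W k c i)
          × m ≡ a + sumTo (λ j → x j * l j) n)

{-# OPTIONS --safe #-}
module Submission where

-- To find the monochromatic grid in dimensions 1, …, m+1,
-- colour each height y of the last coordinate by the whole vector of colours of the
-- m-dimensional grid sitting at that height; there are c ^ (W_1 ⋯ W_m) such vectors,
-- so W_{m+1} = W(k_{m+1}, c ^ (W_0 ⋯ W_m)) heights contain a progression of length
-- k_{m+1} of identically coloured layers. By induction the layer at its first height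
-- contains a monochromatic grid, which is then repeated at every height of the progression.

open import Defs
open import Data.Nat using (ℕ; zero; suc; _+_; _*_; _∸_; _^_; _≤_; _<_; z≤n; s≤s; s≤s⁻¹; _≟_; >-nonZero)
open import Data.Nat.Properties
open import Data.Fin using (Fin; toℕ; fromℕ<; combine; remQuot; funToFin; finToFun)
  renaming (zero to fzero)
open import Data.Fin.Properties using (remQuot-combine; toℕ-fromℕ<; finToFun-funToFin)
open import Data.Product using (Σ; _×_; ∃-syntax; _,_; proj₁; proj₂)
open import Data.Sum using (inj₁; inj₂)
open import Data.Empty using (⊥-elim)
open import Relation.Nullary using (yes; no)
open import Relation.Binary.PropositionalEquality
open import Algebra.Properties.CommutativeSemigroup +-commutativeSemigroup using (interchange)

Box : (ℕ → ℕ) → ℕ → (ℕ → ℕ) → Set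
Box bound m x = (i : ℕ) → 1 ≤ i → i ≤ m → x i < bound i

prodTo : (ℕ → ℕ) → ℕ → ℕ
prodTo N zero = 1
prodTo N (suc m) = prodTo N m * N (suc m)

sumTo-cong : (f g : ℕ → ℕ) (m : ℕ) → ((j : ℕ) → 1 ≤ j → j ≤ m → f j ≡ g j) →
             sumTo f m ≡ sumTo g m
sumTo-cong f g zero f≡g = refl
sumTo-cong f g (suc m) f≡g =
  cong₂ _+_ (sumTo-cong f g m (λ j 1≤j j≤m → f≡g j 1≤j (m≤n⇒m≤1+n j≤m)))
            (f≡g (suc m) (s≤s z≤n) ≤-refl)

sumTo-+ : (f g : ℕ → ℕ) (m : ℕ) → sumTo (λ j → f j + g j) m ≡ sumTo f m + sumTo g m
sumTo-+ f g zero = refl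
sumTo-+ f g (suc m) =
  trans (cong (_+ (f (suc m) + g (suc m))) (sumTo-+ f g m))
        (interchange (sumTo f m) (sumTo g m) (f (suc m)) (g (suc m)))

sumTo-progression : (a : ℕ) (b x α l : ℕ → ℕ) (m : ℕ) →
  a + sumTo (λ j → b j * l j) m + sumTo (λ j → x j * (α j * l j)) m
    ≡ a + sumTo (λ j → (b j + x j * α j) * l j) m
sumTo-progression a b x α l m =
  trans (+-assoc a _ _)
        (cong (a +_) (trans (sym (sumTo-+ (λ j → b j * l j) (λ j → x j * (α j * l j)) m))
                            (sumTo-cong _ _ m (λ j _ _ → sym (distrib j)))))
  where
    distrib : (j : ℕ) → (b j + x j * α j) * l j ≡ b j * l j + x j * (α j * l j)
    distrib j = trans (*-distribʳ-+ (l j) (b j) (x j * α j))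
                      (cong (b j * l j +_) (*-assoc (x j) (α j) (l j)))

progressionTerm< : ∀ {x k b α N} → x < k → b + α * (k ∸ 1) < N → b + x * α < N
progressionTerm< {x} {k} {b} {α} x<k last<N =
  ≤-<-trans (+-monoʳ-≤ b (subst (_≤ α * (k ∸ 1)) (*-comm α x) (*-monoʳ-≤ α (<⇒≤pred x<k))))
            last<N

ascending⇒first≤ : (k : ℕ → ℕ) (n : ℕ) → ((i : ℕ) → 1 ≤ i → i < n → k i ≤ k (suc i)) →
                   (i : ℕ) → 1 ≤ i → i ≤ n → k 1 ≤ k i
ascending⇒first≤ k n ascending (suc zero) _ _ = ≤-refl
ascending⇒first≤ k n ascending (suc (suc i)) _ i+2≤n =
  ≤-trans (ascending⇒first≤ k n ascending (suc i) (s≤s z≤n) (≤-trans (n≤1+n _) i+2≤n))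
          (ascending (suc i) (s≤s z≤n) i+2≤n)

funToFin-≡⇒≗ : ∀ {m n} {f g : Fin m → Fin n} → funToFin f ≡ funToFin g → ∀ t → f t ≡ g t
funToFin-≡⇒≗ {f = f} {g} eq t =
  trans (sym (finToFun-funToFin f t))
        (trans (cong (λ v → finToFun v t) eq) (finToFun-funToFin g t))

extend : (ℕ → ℕ) → ℕ → ℕ → ℕ → ℕ
extend f m v i with i ≟ suc m
... | yes _ = v
... | no _ = f i

extend-new : ∀ f m v → extend f m v (suc m) ≡ v
extend-new f m v with suc m ≟ suc m
... | yes _ = refl
... | no ne = ⊥-elim (ne refl)

extend-old : ∀ f m v i → i ≤ m → extend f m v i ≡ f i
extend-old f m v i i≤m with i ≟ suc m
... | yes refl = ⊥-elim (1+n≰n i≤m)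
... | no _ = refl

module Grid (N l : ℕ → ℕ) where

  gridPoint : (m : ℕ) → Fin (prodTo N m) → ℕ
  gridPoint zero t = 0
  gridPoint (suc m) t = gridPoint m (proj₁ (remQuot {prodTo N m} (N (suc m)) t))
                        + toℕ (proj₂ (remQuot {prodTo N m} (N (suc m)) t)) * l (suc m)

  gridPoint-surjective : (m : ℕ) (y : ℕ → ℕ) → Box N m y →
                         ∃[ t ] gridPoint m t ≡ sumTo (λ j → y j * l j) m
  gridPoint-surjective zero y _ = fzero , refl
  gridPoint-surjective (suc m) y y∈Box
    with gridPoint-surjective m y (λ i 1≤i i≤m → y∈Box i 1≤i (m≤n⇒m≤1+n i≤m))
  ... | t , t↦y = combine t r , trans (cong (λ p → gridPoint m (proj₁ p) + toℕ (proj₂ p) * l (suc m))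
                                              (remQuot-combine {k = N (suc m)} t r))
                                        (cong₂ (λ u v → u + v * l (suc m)) t↦y (toℕ-fromℕ< y<N))
    where
      y<N = y∈Box (suc m) (s≤s z≤n) ≤-refl
      r = fromℕ< y<N

module _ {c : ℕ} (χ : ℕ → Fin c) (N k l : ℕ → ℕ) where
  open Grid N l

  -- Heights are shifted by one because progressions in HasVdW live in {1, …, N}.
  layerColour : (m B y : ℕ) → Fin (c ^ prodTo N m)
  layerColour m B y = funToFin (λ t → χ (B + (y ∸ 1) * l (suc m) + gridPoint m t))

  layerColour-≡ : ∀ m B y y′ → layerColour m B y ≡ layerColour m B y′ →
    (z : ℕ → ℕ) → Box N m z →
    χ (B + (y ∸ 1) * l (suc m) + sumTo (λ j → z j * l j) m)
      ≡ χ (B + (y′ ∸ 1) * l (suc m) + sumTo (λ j → z j * l j) m)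
  layerColour-≡ m B y y′ same z z∈Box with gridPoint-surjective m z z∈Box
  ... | t , t↦z = subst (λ p → χ (B + (y ∸ 1) * l (suc m) + p) ≡ χ (B + (y′ ∸ 1) * l (suc m) + p))
                          t↦z (funToFin-≡⇒≗ same t)

  FitsIn : ℕ → (ℕ → ℕ) → (ℕ → ℕ) → Set
  FitsIn m b α = (i : ℕ) → 1 ≤ i → i ≤ m → 1 ≤ α i × b i + α i * (k i ∸ 1) < N i

  monochromaticSubgrid : (m : ℕ) →
    ((i : ℕ) → i < m → HasVdW (k (suc i)) (c ^ prodTo N i) (N (suc i))) → (B : ℕ) →
    Σ (ℕ → ℕ) λ b → Σ (ℕ → ℕ) λ α → FitsIn m b α ×
      Σ (Fin c) λ col → (x : ℕ → ℕ) → Box k m x →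
        χ (B + sumTo (λ j → (b j + x j * α j) * l j) m) ≡ col
  monochromaticSubgrid zero _ B =
    (λ _ → 0) , (λ _ → 0) , (λ i 1≤i i≤0 → ⊥-elim (1+n≰n (≤-trans 1≤i i≤0))) ,
    χ (B + 0) , λ _ _ → refl
  monochromaticSubgrid (suc m) vdw B with vdw m ≤-refl (layerColour m B)
  ... | suc a , δ , _ , 1≤δ , last≤N , sameLayers
      with monochromaticSubgrid m (λ i i<m → vdw i (m<n⇒m<1+n i<m)) (B + a * l (suc m))
  ... | b , α , fits , col , mono = extend b m a , extend α m δ , fits′ , col , mono′
    where
      fits′ : FitsIn (suc m) (extend b m a) (extend α m δ)
      fits′ i 1≤i i≤m+1 with m≤n⇒m<n∨m≡n i≤m+1
      ... | inj₁ i<m+1 rewrite extend-old b m a i (s≤s⁻¹ i<m+1) | extend-old α m δ i (s≤s⁻¹ i<m+1)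
        = fits i 1≤i (s≤s⁻¹ i<m+1)
      ... | inj₂ refl rewrite extend-new b m a | extend-new α m δ
        = 1≤δ , subst (λ s → a + s < N (suc m)) (*-comm (k (suc m) ∸ 1) δ) last≤N

      mono′ : (x : ℕ → ℕ) → Box k (suc m) x →
        χ (B + sumTo (λ j → (extend b m a j + x j * extend α m δ j) * l j) (suc m)) ≡ col
      mono′ x x∈Box = begin
        χ (B + (sumTo (λ j → (extend b m a j + x j * extend α m δ j) * l j) m
                 + (extend b m a (suc m) + x (suc m) * extend α m δ (suc m)) * L))
          ≡⟨ cong₂ (λ s y → χ (B + (s + y * L))) (sumTo-cong _ _ m old) top ⟩
        χ (B + (S + (a + x (suc m) * δ) * L))
          ≡⟨ cong χ (trans (cong (B +_) (+-comm S _)) (sym (+-assoc B _ S))) ⟩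
        χ (B + (a + x (suc m) * δ) * L + S)
          ≡⟨ layerColour-≡ m B (suc a + x (suc m) * δ) (suc a)
               (sameLayers (x (suc m)) (x∈Box (suc m) (s≤s z≤n) ≤-refl))
               (λ j → b j + x j * α j) inside ⟩
        χ (B + a * L + S)
          ≡⟨ mono x (λ i 1≤i i≤m → x∈Box i 1≤i (m≤n⇒m≤1+n i≤m)) ⟩
        col ∎
        where
          open ≡-Reasoning
          L = l (suc m)
          S = sumTo (λ j → (b j + x j * α j) * l j) m
          old : (j : ℕ) → 1 ≤ j → j ≤ m →
                (extend b m a j + x j * extend α m δ j) * l j ≡ (b j + x j * α j) * l j
          old j _ j≤m rewrite extend-old b m a j j≤m | extend-old α m δ j j≤m = refl
          top : extend b m a (suc m) + x (suc m) * extend α m δ (suc m) ≡ a + x (suc m) * δ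
          top = cong₂ (λ u v → u + x (suc m) * v) (extend-new b m a) (extend-new α m δ)
          inside : Box N m (λ j → b j + x j * α j)
          inside i 1≤i i≤m =
            progressionTerm< (x∈Box i 1≤i (m≤n⇒m≤1+n i≤m)) (proj₂ (fits i 1≤i i≤m))

prodTo-Wseq : ∀ W k c i → prodTo (Wseq W k c) i ≡ Wprod W k c i
prodTo-Wseq W k c zero = refl
prodTo-Wseq W k c (suc i) = cong (_* Wseq W k c (suc i)) (prodTo-Wseq W k c i)

Wseq-hasVdW : (W : ℕ → ℕ → ℕ) → IsVdWFunction W → (c n : ℕ) (k : ℕ → ℕ) → 1 ≤ c →
  ((i : ℕ) → 1 ≤ i → i ≤ n → 2 ≤ k i) →
  (i : ℕ) → i < n → HasVdW (k (suc i)) (c ^ prodTo (Wseq W k c) i) (Wseq W k c (suc i))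
Wseq-hasVdW W vdw c n k 1≤c k≥2 i i<n
  rewrite prodTo-Wseq W k c i =
  proj₁ (vdw (k (suc i)) (c ^ Wprod W k c i) (k≥2 (suc i) (s≤s z≤n) i<n)
             (m^n>0 c {{>-nonZero 1≤c}} (Wprod W k c i)))

proposition2p1 :
    (W : ℕ → ℕ → ℕ) → IsVdWFunction W →
    (a c n : ℕ) → (k l : ℕ → ℕ) →
    1 ≤ a → 1 ≤ c → 1 ≤ n →
    2 ≤ k 1 →
    ((i : ℕ) → 1 ≤ i → i < n → k i ≤ k (suc i)) →
    ((i : ℕ) → 1 ≤ i → i ≤ n → 1 ≤ l i) →
    ((i : ℕ) → 1 ≤ i → i < n →
      sumTo (λ j → (Wseq W k c j ∸ 1) * l j) i < l (suc i)) →
    (χ : ℕ → Fin c) →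
    Σ ℕ λ an → Σ (ℕ → ℕ) λ d → Σ (ℕ → ℕ) λ α →
      (1 ≤ an
       × ((i : ℕ) → 1 ≤ i → i ≤ n →
            1 ≤ d i × d i ≡ α i * l i × 1 ≤ α i
            × α i * (k i ∸ 1) ≤ Wseq W k c i ∸ 1)
       × ((x : ℕ → ℕ) → ((i : ℕ) → 1 ≤ i → i ≤ n → x i < k i) →
            InA W k c n l a (an + sumTo (λ j → x j * d j) n))
       × Σ (Fin c) λ col → ((x : ℕ → ℕ) → ((i : ℕ) → 1 ≤ i → i ≤ n → x i < k i) →
            χ (an + sumTo (λ j → x j * d j) n) ≡ col))
proposition2p1 W vdw a c n k l 1≤a 1≤c _ 2≤k₁ ascending 1≤l _ χ
  with monochromaticSubgrid χ (Wseq W k c) k l n (Wseq-hasVdW W vdw c n k 1≤c k≥2) a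
  where
    k≥2 : (i : ℕ) → 1 ≤ i → i ≤ n → 2 ≤ k i
    k≥2 i 1≤i i≤n = ≤-trans 2≤k₁ (ascending⇒first≤ k n ascending i 1≤i i≤n)
... | b , α , fits , col , mono = an , d , α , ≤-trans 1≤a (m≤m+n a _) , steps , inA , col , mono′
  where
    an = a + sumTo (λ j → b j * l j) n
    d = λ j → α j * l j
    point : ∀ x → an + sumTo (λ j → x j * d j) n ≡ a + sumTo (λ j → (b j + x j * α j) * l j) n
    point x = sumTo-progression a b x α l n
    steps : (i : ℕ) → 1 ≤ i → i ≤ n →
            1 ≤ d i × d i ≡ α i * l i × 1 ≤ α i × α i * (k i ∸ 1) ≤ Wseq W k c i ∸ 1
    steps i 1≤i i≤n = *-mono-≤ (proj₁ (fits i 1≤i i≤n)) (1≤l i 1≤i i≤n) , refl ,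
      proj₁ (fits i 1≤i i≤n) , <⇒≤pred (≤-<-trans (m≤n+m _ (b i)) (proj₂ (fits i 1≤i i≤n)))
    inA : (x : ℕ → ℕ) → Box k n x → InA W k c n l a (an + sumTo (λ j → x j * d j) n)
    inA x x∈Box = (λ j → b j + x j * α j) ,
      (λ i 1≤i i≤n → progressionTerm< (x∈Box i 1≤i i≤n) (proj₂ (fits i 1≤i i≤n))) , point x
    mono′ : (x : ℕ → ℕ) → Box k n x → χ (an + sumTo (λ j → x j * d j) n) ≡ col
    mono′ x x∈Box = trans (cong χ (point x)) (mono x x∈Box)
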